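{- Fix integers $d\ge1$ and $k\ge1$. Let $\mathbf{C}_{2k}$ be the $2k\times 2k$ matrix with entries $(\mathbf{C}_{2k})_{i,j}=\hat c_{(j-i)\bmod 2k}$ and $\mathbf{B}_{2k}$ the $2k\times2k$ matrix with entries $(\mathbf{B}_{2k})_{i,j}=b_{(j-i)\bmod 2k}$ ($0\le i,j\le 2k-1$), where $$\hat c_m=\Big[\tfrac{1}{L(t)}\Big]_{2k,m},\qquad b_m=\Big[\tfrac{1}{L(t)\,(1-4d^2t)}\Big]_{2k,m},\qquad 0\le m\le 2k-1.$$ Let $\tilde C$ be a square submatrix of $\mathbf{C}_{2k}$ whose columns are consecutive columns of $\mathbf{C}_{2k}$, and let $\tilde B$ be the submatrix of $\mathbf{B}_{2k}$ with the same row and column indices. If the first column of $\tilde C$ is replaced by the first column of $\tilde B$, the resulting matrix has determinant equal to $\det(\tilde B)$.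
   Context: $L(t)=\sum_{n\ge0}L_nt^n\in\mathbb{Q}[\![t]\!]$, where $L_n$ is the number of loops of length $2n$ in $\mathbb{Z}^d$, i.e. sequences of $2n$ steps from $\{ -1,1\}^d$ summing to the zero vector ($L_0=1$). For $G(t)=\sum_ig_it^i$ and $0\le m<q$, the multisection is $[G(t)]_{q,m}=\sum_{i\ge0}g_{qi+m}t^{qi+m}$. Column indices are taken in $\{0,\dots,2k-1\}$ and "consecutive" means consecutive in this order. -}

module Defs where

open import Data.Nat as ℕ using (ℕ; zero; suc; _∸_; NonZero)
open import Data.Nat.Properties using (m*n≢0)
open import Data.Nat.DivMod using (_%_)
open import Data.Integer as ℤ using (ℤ)
open import Data.Rational as ℚ using (ℚ; 0ℚ; 1ℚ)
open import Data.Fin using (Fin; toℕ; punchIn)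
import Data.Fin as Fin
open import Data.Vec as Vec using (Vec; []; _∷_)
open import Data.Vec.Properties using (≡-dec)
open import Data.List as List using (List; []; _∷_; concatMap; filter; length)
open import Data.Bool using (if_then_else_)
open import Relation.Nullary.Decidable using (⌊_⌋)

steps : (d : ℕ) → List (Vec ℤ d)
steps zero    = [] ∷ []
steps (suc d) = concatMap (λ v → (ℤ.+ 1 ∷ v) ∷ (ℤ.-[1+ 0 ] ∷ v) ∷ []) (steps d)

walks : (d m : ℕ) → List (List (Vec ℤ d))
walks d zero    = [] ∷ []
walks d (suc m) = concatMap (λ w → List.map (λ s → s ∷ w) (steps d)) (walks d m)

zeroV : (d : ℕ) → Vec ℤ d
zeroV d = Vec.replicate d (ℤ.+ 0)

endpoint : {d : ℕ} → List (Vec ℤ d) → Vec ℤ d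
endpoint {d} = List.foldr (Vec.zipWith ℤ._+_) (zeroV d)

loops : (d n : ℕ) → ℕ
loops d n = length (filter (λ w → ≡-dec ℤ._≟_ (endpoint w) (zeroV d)) (walks d (2 ℕ.* n)))

Series : Set
Series = ℕ → ℚ

oneS : Series
oneS zero    = 1ℚ
oneS (suc _) = 0ℚ

zeroS : Series
zeroS _ = 0ℚ

_+S_ : Series → Series → Series
(f +S g) n = f n ℚ.+ g n

-S_ : Series → Series
(-S f) n = ℚ.- f n

sumTo : ℕ → (ℕ → ℚ) → ℚ
sumTo zero    h = h zero
sumTo (suc n) h = sumTo n h ℚ.+ h (suc n)

_*S_ : Series → Series → Series
(f *S g) n = sumTo n (λ i → f i ℚ.* g (n ∸ i))

Lser : ℕ → Series
Lser d n = (ℤ.+ (loops d n)) ℚ./ 1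

-- 1/(1 - 4 d^2 t) = Σ (4 d^2)^n t^n
geomS : ℕ → Series
geomS d n = (ℤ.+ ((4 ℕ.* (d ℕ.* d)) ℕ.^ n)) ℚ./ 1

multisection : (q : ℕ) → .{{NonZero q}} → ℕ → Series → Series
multisection q m G i = if ⌊ (i % q) ℕ.≟ m ⌋ then G i else 0ℚ

Matrix : ℕ → Set
Matrix n = Fin n → Fin n → Series

sumFinS : (n : ℕ) → (Fin n → Series) → Series
sumFinS zero    f = zeroS
sumFinS (suc n) f = f Fin.zero +S sumFinS n (λ j → f (Fin.suc j))

signS : ℕ → Series → Series
signS zero    f = f
signS (suc n) f = -S (signS n f)

minor : {n : ℕ} → Fin (suc n) → Matrix (suc n) → Matrix n
minor j M r c = M (Fin.suc r) (punchIn j c)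

det : (n : ℕ) → Matrix n → Series
det zero    M = oneS
det (suc n) M = sumFinS (suc n) (λ j → signS (toℕ j) (M Fin.zero j *S det n (minor j M)))

-- (j - i) mod 2k, for 0 ≤ i < 2k
circIdx : (k : ℕ) → .{{NonZero k}} → ℕ → ℕ → ℕ
circIdx k i j = _%_ (j ℕ.+ 2 ℕ.* k ∸ i) (2 ℕ.* k) {{m*n≢0 2 k}}

-- ĉ_m = [1/L]_{2k,m}, given Linv = 1/L
cHat : (k : ℕ) → .{{NonZero k}} → Series → ℕ → Series
cHat k Linv m = multisection (2 ℕ.* k) {{m*n≢0 2 k}} m Linv

bCoef : (d k : ℕ) → .{{NonZero k}} → Series → ℕ → Series
bCoef d k Linv m = multisection (2 ℕ.* k) {{m*n≢0 2 k}} m (Linv *S geomS d)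

Centry : (k : ℕ) → .{{NonZero k}} → Series → ℕ → ℕ → Series
Centry k Linv i j = cHat k Linv (circIdx k i j)

Bentry : (d k : ℕ) → .{{NonZero k}} → Series → ℕ → ℕ → Series
Bentry d k Linv i j = bCoef d k Linv (circIdx k i j)

subMatrix : (k : ℕ) → (ℕ → ℕ → Series) → (s : ℕ) → (Fin (suc s) → Fin (2 ℕ.* k)) → ℕ → Matrix (suc s)
subMatrix k E s ρ c i j = E (toℕ (ρ i)) (c ℕ.+ toℕ j)

replaceFirstCol : {n : ℕ} → Matrix (suc n) → Matrix (suc n) → Matrix (suc n)
replaceFirstCol A B i Fin.zero    = B i Fin.zero
replaceFirstCol A B i (Fin.suc j) = A i (Fin.suc j)

-- Write G = L⁻¹ (1 − 4d²t)⁻¹, so that G = L⁻¹ + 4d²t G. Taking the multisection at residue m + 1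
-- gives b_{m+1} = ĉ_{m+1} + 4d²t b_m (indices mod 2k), i.e. every column of B̃ after the first is
-- the corresponding column of C̃ plus 4d²t times the previous column of B̃. Turning the columns
-- of C̃ into those of B̃ one at a time, from left to right, thus only ever adds a multiple of the
-- adjacent column on the left, which leaves the determinant unchanged.
module Submission where

open import Defs
open import Algebra.Bundles using (CommutativeMonoid)
open import Data.Empty using (⊥-elim)
open import Data.Sum using (inj₁; inj₂)
open import Data.Fin as Fin using (Fin; zero; suc; toℕ; fromℕ<; punchIn; punchOut; _<_)
import Data.Fin.Properties as FinP
open import Data.Integer as ℤ using ()
import Data.Integer.Properties as ℤP
open import Data.Nat as ℕ using (ℕ; zero; suc; _+_; _*_; _∸_; _≤_; _≤?_; z≤n; s≤s; NonZero)
import Data.Nat.Coprimality as Coprimality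
open import Data.Nat.DivMod using (_%_; %-distribˡ-+; [m+n]%n≡m%n)
import Data.Nat.Properties as ℕP
open import Data.Rational as ℚ using (ℚ; 0ℚ; mkℚ)
import Data.Rational.Properties as ℚP
open import Function using (_∘_)
open import Level using (0ℓ)
open import Relation.Binary.Bundles using (Setoid)
open import Relation.Binary.PropositionalEquality
import Relation.Binary.Reasoning.Setoid as SetoidReasoning
open import Relation.Nullary using (¬_; yes; no)

open import Algebra.Properties.CommutativeSemigroup
  (CommutativeMonoid.commutativeSemigroup ℚP.+-0-commutativeMonoid)
  using () renaming (interchange to +-interchange)

sumTo-cong : ∀ n {h h′ : ℕ → ℚ} → (∀ i → i ≤ n → h i ≡ h′ i) → sumTo n h ≡ sumTo n h′
sumTo-cong zero    eq = eq 0 z≤n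
sumTo-cong (suc n) eq =
  cong₂ ℚ._+_ (sumTo-cong n (λ i i≤n → eq i (ℕP.m≤n⇒m≤1+n i≤n))) (eq (suc n) ℕP.≤-refl)

sumTo-zero : ∀ n {h : ℕ → ℚ} → (∀ i → i ≤ n → h i ≡ 0ℚ) → sumTo n h ≡ 0ℚ
sumTo-zero n eq = trans (sumTo-cong n eq) (constZero n)
  where
  constZero : ∀ n → sumTo n (λ _ → 0ℚ) ≡ 0ℚ
  constZero zero    = refl
  constZero (suc n) = cong (ℚ._+ 0ℚ) (constZero n)

sumTo-distrib-+ : ∀ n (h h′ : ℕ → ℚ) →
  sumTo n (λ i → h i ℚ.+ h′ i) ≡ sumTo n h ℚ.+ sumTo n h′
sumTo-distrib-+ zero    h h′ = refl
sumTo-distrib-+ (suc n) h h′ =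
  trans (cong (ℚ._+ (h (suc n) ℚ.+ h′ (suc n))) (sumTo-distrib-+ n h h′))
        (+-interchange (sumTo n h) (sumTo n h′) (h (suc n)) (h′ (suc n)))

sumTo-*ˡ : ∀ n a (h : ℕ → ℚ) → sumTo n (λ i → a ℚ.* h i) ≡ a ℚ.* sumTo n h
sumTo-*ˡ zero    a h = refl
sumTo-*ˡ (suc n) a h =
  trans (cong (ℚ._+ (a ℚ.* h (suc n))) (sumTo-*ˡ n a h)) (sym (ℚP.*-distribˡ-+ a _ _))

sumTo-suc : ∀ n (h : ℕ → ℚ) → sumTo (suc n) h ≡ h 0 ℚ.+ sumTo n (h ∘ suc)
sumTo-suc zero    h = refl
sumTo-suc (suc n) h =
  trans (cong (ℚ._+ h (suc (suc n))) (sumTo-suc n h)) (ℚP.+-assoc (h 0) _ _)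

-- A record rather than a function type, so that both series can be inferred from a proof.
infix 4 _≈_
record _≈_ (f g : Series) : Set where
  constructor mk≈
  field coeff : ∀ n → f n ≡ g n
open _≈_

≈-refl : ∀ {f} → f ≈ f
≈-refl = mk≈ λ _ → refl

≈-reflexive : ∀ {f g} → f ≡ g → f ≈ g
≈-reflexive refl = ≈-refl

≈-sym : ∀ {f g} → f ≈ g → g ≈ f
≈-sym f≈g = mk≈ λ n → sym (coeff f≈g n)

≈-trans : ∀ {f g h} → f ≈ g → g ≈ h → f ≈ h
≈-trans f≈g g≈h = mk≈ λ n → trans (coeff f≈g n) (coeff g≈h n)

≈-setoid : Setoid 0ℓ 0ℓ
≈-setoid = record
  { Carrier       = Series
  ; _≈_           = _≈_
  ; isEquivalence = record { refl = ≈-refl ; sym = ≈-sym ; trans = ≈-trans }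
  }

module ≈-Reasoning = SetoidReasoning ≈-setoid

+S-cong : ∀ {f f′ g g′} → f ≈ f′ → g ≈ g′ → f +S g ≈ f′ +S g′
+S-cong f≈f′ g≈g′ = mk≈ λ n → cong₂ ℚ._+_ (coeff f≈f′ n) (coeff g≈g′ n)

+S-congˡ : ∀ f {g g′} → g ≈ g′ → f +S g ≈ f +S g′
+S-congˡ f = +S-cong (≈-refl {f})

+S-identityʳ : ∀ f → f +S zeroS ≈ f
+S-identityʳ f = mk≈ λ n → ℚP.+-identityʳ (f n)

-S-cong : ∀ {f f′} → f ≈ f′ → -S f ≈ -S f′
-S-cong f≈f′ = mk≈ λ n → cong ℚ.-_ (coeff f≈f′ n)

*S-cong : ∀ {f f′ g g′} → f ≈ f′ → g ≈ g′ → f *S g ≈ f′ *S g′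
*S-cong f≈f′ g≈g′ = mk≈ λ n →
  sumTo-cong n (λ i _ → cong₂ ℚ._*_ (coeff f≈f′ i) (coeff g≈g′ (n ∸ i)))

*S-congˡ : ∀ f {g g′} → g ≈ g′ → f *S g ≈ f *S g′
*S-congˡ f = *S-cong (≈-refl {f})

*S-congʳ : ∀ g {f f′} → f ≈ f′ → f *S g ≈ f′ *S g
*S-congʳ g f≈f′ = *S-cong f≈f′ (≈-refl {g})

*S-distribˡ-+S : ∀ f g h → f *S (g +S h) ≈ (f *S g) +S (f *S h)
*S-distribˡ-+S f g h = mk≈ λ n →
  trans (sumTo-cong n (λ i _ → ℚP.*-distribˡ-+ (f i) _ _)) (sumTo-distrib-+ n _ _)

*S-distribʳ-+S : ∀ f g h → (g +S h) *S f ≈ (g *S f) +S (h *S f)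
*S-distribʳ-+S f g h = mk≈ λ n →
  trans (sumTo-cong n (λ i _ → ℚP.*-distribʳ-+ (f (n ∸ i)) (g i) (h i))) (sumTo-distrib-+ n _ _)

*S-zeroʳ : ∀ f → f *S zeroS ≈ zeroS
*S-zeroʳ f = mk≈ λ n → sumTo-zero n (λ i _ → ℚP.*-zeroʳ (f i))

*S-identityʳ : ∀ f → f *S oneS ≈ f
*S-identityʳ f = mk≈ coefficient
  where
  coefficient : ∀ n → (f *S oneS) n ≡ f n
  coefficient zero    = ℚP.*-identityʳ (f 0)
  coefficient (suc n) =
    trans (cong₂ ℚ._+_ (sumTo-zero n lowerTerm) lastTerm) (ℚP.+-identityˡ (f (suc n)))
    where
    lowerTerm : ∀ i → i ≤ n → f i ℚ.* oneS (suc n ∸ i) ≡ 0ℚ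
    lowerTerm i i≤n =
      trans (cong (λ m → f i ℚ.* oneS m) (ℕP.+-∸-assoc 1 i≤n)) (ℚP.*-zeroʳ (f i))
    lastTerm : f (suc n) ℚ.* oneS (n ∸ n) ≡ f (suc n)
    lastTerm = trans (cong (λ m → f (suc n) ℚ.* oneS m) (ℕP.n∸n≡0 n)) (ℚP.*-identityʳ (f (suc n)))

-- (α ·t f) is the series α t · f.
infixr 25 _·t_
_·t_ : ℚ → Series → Series
(α ·t f) zero    = 0ℚ
(α ·t f) (suc n) = α ℚ.* f n

module _ {α : ℚ} where

  ·t-+S : ∀ f g → α ·t (f +S g) ≈ α ·t f +S α ·t g
  ·t-+S f g = mk≈ λ where
    zero    → sym (ℚP.+-identityˡ 0ℚ)
    (suc n) → ℚP.*-distribˡ-+ α (f n) (g n)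

  ·t-neg : ∀ f → α ·t (-S f) ≈ -S (α ·t f)
  ·t-neg f = mk≈ λ where
    zero    → refl
    (suc n) → sym (ℚP.neg-distribʳ-* α (f n))

  ·t-zero : α ·t zeroS ≈ zeroS
  ·t-zero = mk≈ λ where
    zero    → refl
    (suc n) → ℚP.*-zeroʳ α

  ·t-*S : ∀ f g → (α ·t f) *S g ≈ α ·t (f *S g)
  ·t-*S f g = mk≈ coefficient
    where
    open ≡-Reasoning
    coefficient : ∀ n → ((α ·t f) *S g) n ≡ (α ·t (f *S g)) n
    coefficient zero    = ℚP.*-zeroˡ (g 0)
    coefficient (suc n) = begin
      sumTo (suc n) (λ i → (α ·t f) i ℚ.* g (suc n ∸ i))
        ≡⟨ sumTo-suc n _ ⟩
      0ℚ ℚ.* g (suc n) ℚ.+ sumTo n (λ i → (α ℚ.* f i) ℚ.* g (n ∸ i))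
        ≡⟨ cong₂ ℚ._+_ (ℚP.*-zeroˡ (g (suc n))) (sumTo-cong n (λ i _ → ℚP.*-assoc α (f i) _)) ⟩
      0ℚ ℚ.+ sumTo n (λ i → α ℚ.* (f i ℚ.* g (n ∸ i)))
        ≡⟨ trans (ℚP.+-identityˡ _) (sumTo-*ˡ n α _) ⟩
      α ℚ.* (f *S g) n ∎

  *S-·t : ∀ f g → f *S (α ·t g) ≈ α ·t (f *S g)
  *S-·t f g = mk≈ coefficient
    where
    open ≡-Reasoning
    coefficient : ∀ n → (f *S (α ·t g)) n ≡ (α ·t (f *S g)) n
    coefficient zero    = ℚP.*-zeroʳ (f 0)
    coefficient (suc n) = begin
      sumTo n (λ i → f i ℚ.* (α ·t g) (suc n ∸ i)) ℚ.+ f (suc n) ℚ.* (α ·t g) (n ∸ n)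
        ≡⟨ cong₂ ℚ._+_ (sumTo-cong n lowerTerm) lastTerm ⟩
      sumTo n (λ i → α ℚ.* (f i ℚ.* g (n ∸ i))) ℚ.+ 0ℚ
        ≡⟨ trans (ℚP.+-identityʳ _) (sumTo-*ˡ n α _) ⟩
      α ℚ.* (f *S g) n ∎
      where
      lowerTerm : ∀ i → i ≤ n → f i ℚ.* (α ·t g) (suc n ∸ i) ≡ α ℚ.* (f i ℚ.* g (n ∸ i))
      lowerTerm i i≤n = begin
        f i ℚ.* (α ·t g) (suc n ∸ i)  ≡⟨ cong (λ m → f i ℚ.* (α ·t g) m) (ℕP.+-∸-assoc 1 i≤n) ⟩
        f i ℚ.* (α ℚ.* g (n ∸ i))     ≡⟨ ℚP.*-assoc (f i) α _ ⟨
        (f i ℚ.* α) ℚ.* g (n ∸ i)     ≡⟨ cong (ℚ._* g (n ∸ i)) (ℚP.*-comm (f i) α) ⟩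
        (α ℚ.* f i) ℚ.* g (n ∸ i)     ≡⟨ ℚP.*-assoc α (f i) _ ⟩
        α ℚ.* (f i ℚ.* g (n ∸ i))     ∎
      lastTerm : f (suc n) ℚ.* (α ·t g) (n ∸ n) ≡ 0ℚ
      lastTerm = trans (cong (λ m → f (suc n) ℚ.* (α ·t g) m) (ℕP.n∸n≡0 n)) (ℚP.*-zeroʳ (f (suc n)))

signS-cong : ∀ k {f g} → f ≈ g → signS k f ≈ signS k g
signS-cong zero    f≈g = f≈g
signS-cong (suc k) f≈g = -S-cong (signS-cong k f≈g)

signS-+S : ∀ k f g → signS k (f +S g) ≈ signS k f +S signS k g
signS-+S zero    f g = ≈-refl
signS-+S (suc k) f g = mk≈ λ n →
  trans (cong ℚ.-_ (coeff (signS-+S k f g) n)) (ℚP.neg-distrib-+ (signS k f n) (signS k g n))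

signS-zero : ∀ k → signS k zeroS ≈ zeroS
signS-zero zero    = ≈-refl
signS-zero (suc k) = -S-cong (signS-zero k)

signS-·t : ∀ {α} k f → signS k (α ·t f) ≈ α ·t signS k f
signS-·t zero    f = ≈-refl
signS-·t (suc k) f = ≈-trans (-S-cong (signS-·t k f)) (≈-sym (·t-neg (signS k f)))

sumFinS-cong : ∀ n {f g : Fin n → Series} → (∀ j → f j ≈ g j) → sumFinS n f ≈ sumFinS n g
sumFinS-cong zero    _   = ≈-refl
sumFinS-cong (suc n) f≈g = +S-cong (f≈g zero) (sumFinS-cong n (f≈g ∘ suc))

sumFinS-+S : ∀ n (f g : Fin n → Series) →
  sumFinS n (λ j → f j +S g j) ≈ sumFinS n f +S sumFinS n g
sumFinS-+S zero    f g = mk≈ λ _ → sym (ℚP.+-identityˡ 0ℚ)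
sumFinS-+S (suc n) f g = mk≈ λ m →
  trans (cong (f zero m ℚ.+ g zero m ℚ.+_) (coeff (sumFinS-+S n (f ∘ suc) (g ∘ suc)) m))
        (+-interchange (f zero m) (g zero m) (sumFinS n (f ∘ suc) m) (sumFinS n (g ∘ suc) m))

sumFinS-·t : ∀ {α} n (f : Fin n → Series) → sumFinS n (λ j → α ·t f j) ≈ α ·t sumFinS n f
sumFinS-·t zero    f = ≈-sym ·t-zero
sumFinS-·t {α} (suc n) f =
  ≈-trans (+S-congˡ (α ·t f zero) (sumFinS-·t n (f ∘ suc)))
          (≈-sym (·t-+S (f zero) (sumFinS n (f ∘ suc))))

sumFinS-zero : ∀ n (f : Fin n → Series) → (∀ j → f j ≈ zeroS) → sumFinS n f ≈ zeroS
sumFinS-zero zero    f _  = ≈-refl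
sumFinS-zero (suc n) f f≈0 =
  ≈-trans (+S-cong (f≈0 zero) (sumFinS-zero n (f ∘ suc) (f≈0 ∘ suc))) (+S-identityʳ zeroS)

sumFinS-single : ∀ n (f : Fin n → Series) a → (∀ j → j ≢ a → f j ≈ zeroS) → sumFinS n f ≈ f a
sumFinS-single (suc n) f zero    f≈0 =
  ≈-trans (+S-congˡ (f zero) (sumFinS-zero n (f ∘ suc) (λ j → f≈0 (suc j) λ ())))
          (+S-identityʳ (f zero))
sumFinS-single (suc n) f (suc a) f≈0 =
  ≈-trans (+S-cong (f≈0 zero λ ())
                   (sumFinS-single n (f ∘ suc) a (λ j j≢a → f≈0 (suc j) (j≢a ∘ FinP.suc-injective))))
          (mk≈ λ m → ℚP.+-identityˡ (f (suc a) m))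

sumFinS-pair : ∀ n (f : Fin n → Series) {a b} → a ≢ b → (∀ j → j ≢ a → j ≢ b → f j ≈ zeroS) →
  sumFinS n f ≈ f a +S f b
sumFinS-pair (suc n) f {zero}  {zero}  a≢b _   = ⊥-elim (a≢b refl)
sumFinS-pair (suc n) f {zero}  {suc b} _   f≈0 =
  +S-congˡ (f zero)
    (sumFinS-single n (f ∘ suc) b (λ j j≢b → f≈0 (suc j) (λ ()) (j≢b ∘ FinP.suc-injective)))
sumFinS-pair (suc n) f {suc a} {zero}  _   f≈0 = ≈-trans
  (+S-congˡ (f zero)
    (sumFinS-single n (f ∘ suc) a (λ j j≢a → f≈0 (suc j) (j≢a ∘ FinP.suc-injective) (λ ()))))
  (mk≈ λ m → ℚP.+-comm (f zero m) (f (suc a) m))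
sumFinS-pair (suc n) f {suc a} {suc b} a≢b f≈0 = ≈-trans
  (+S-cong (f≈0 zero (λ ()) (λ ()))
           (sumFinS-pair n (f ∘ suc) (a≢b ∘ cong suc)
             (λ j j≢a j≢b → f≈0 (suc j) (j≢a ∘ FinP.suc-injective) (j≢b ∘ FinP.suc-injective))))
  (mk≈ λ m → ℚP.+-identityˡ (f (suc a) m ℚ.+ f (suc b) m))

-- Determinants of matrices of series

Adjacent : ∀ {n} → Fin n → Fin n → Set
Adjacent a b = toℕ b ≡ suc (toℕ a)

Adjacent⇒≢ : ∀ {n} {a b : Fin n} → Adjacent a b → a ≢ b
Adjacent⇒≢ ab refl = ℕP.1+n≢n (sym ab)

punchOut-adjacent : ∀ {n} {j a b : Fin (suc n)} → Adjacent a b →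
  (j≢a : j ≢ a) (j≢b : j ≢ b) → Adjacent (punchOut j≢a) (punchOut j≢b)
punchOut-adjacent {_} {zero} {zero} _ j≢a _ = ⊥-elim (j≢a refl)
punchOut-adjacent {_} {zero} {suc a} {suc b} ab _ _ = ℕP.suc-injective ab
punchOut-adjacent {suc _} {suc zero} {zero} {suc zero} _ _ j≢b = ⊥-elim (j≢b refl)
punchOut-adjacent {suc (suc _)} {suc (suc j)} {zero} {suc zero} _ _ _ = refl
punchOut-adjacent {suc _} {suc j} {suc a} {suc b} ab j≢a j≢b =
  cong suc (punchOut-adjacent (ℕP.suc-injective ab) (j≢a ∘ cong suc) (j≢b ∘ cong suc))

punchIn-punchOut-adjacent : ∀ {n} {a b : Fin (suc n)} → Adjacent a b →
  (a≢b : a ≢ b) → punchIn b (punchOut a≢b) ≡ a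
punchIn-punchOut-adjacent {_} {zero} {suc zero} _ _ = refl
punchIn-punchOut-adjacent {suc _} {suc a} {suc b} ab a≢b =
  cong suc (punchIn-punchOut-adjacent (ℕP.suc-injective ab) (a≢b ∘ cong suc))

punchIn-adjacent : ∀ {n} {a b : Fin (suc n)} → Adjacent a b →
  (a≢b : a ≢ b) {c : Fin n} → c ≢ punchOut a≢b → punchIn a c ≡ punchIn b c
punchIn-adjacent {_} {zero} {suc zero} _ _ {zero}  c≢ = ⊥-elim (c≢ refl)
punchIn-adjacent {_} {zero} {suc zero} _ _ {suc c} _  = refl
punchIn-adjacent {suc _} {suc a} {suc b} _ _ {zero} _ = refl
punchIn-adjacent {suc _} {suc a} {suc b} ab a≢b {suc c} c≢ =
  cong suc (punchIn-adjacent (ℕP.suc-injective ab) (a≢b ∘ cong suc) (c≢ ∘ cong suc))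

AgreeOffColumn : ∀ {n} → Fin n → Matrix n → Matrix n → Set
AgreeOffColumn p M M′ = ∀ i j → j ≢ p → M i j ≈ M′ i j

laplaceTerm : ∀ n → Matrix (suc n) → Fin (suc n) → Series
laplaceTerm n M j = signS (toℕ j) (M zero j *S det n (minor j M))

det-cong : ∀ n {M M′ : Matrix n} → (∀ i j → M i j ≈ M′ i j) → det n M ≈ det n M′
det-cong zero    _    = ≈-refl
det-cong (suc n) M≈M′ = sumFinS-cong (suc n) λ j → signS-cong (toℕ j)
  (*S-cong (M≈M′ zero j) (det-cong n λ r c → M≈M′ (suc r) (punchIn j c)))

minor-agree : ∀ {n} {p : Fin (suc n)} {M M′} → AgreeOffColumn p M M′ →
  ∀ r c → minor p M r c ≈ minor p M′ r c
minor-agree {p = p} M≈M′ r c = M≈M′ (suc r) (punchIn p c) (FinP.punchInᵢ≢i p c)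

minor-agreeOffColumn : ∀ {n} {j p : Fin (suc n)} {M M′} (j≢p : j ≢ p) → AgreeOffColumn p M M′ →
  AgreeOffColumn (punchOut j≢p) (minor j M) (minor j M′)
minor-agreeOffColumn {j = j} j≢p M≈M′ r c c≢p′ = M≈M′ (suc r) (punchIn j c) λ jc≡p →
  c≢p′ (FinP.punchIn-injective j c _ (trans jc≡p (sym (FinP.punchIn-punchOut j≢p))))

det-linear-column : ∀ n (p : Fin n) {M M₁ M₂ : Matrix n} →
  (∀ i → M i p ≈ M₁ i p +S M₂ i p) → AgreeOffColumn p M M₁ → AgreeOffColumn p M M₂ →
  det n M ≈ det n M₁ +S det n M₂
det-linear-column (suc n) p {M} {M₁} {M₂} column M≈M₁ M≈M₂ =
  ≈-trans (sumFinS-cong (suc n) term) (sumFinS-+S (suc n) (laplaceTerm n M₁) (laplaceTerm n M₂))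
  where
  open ≈-Reasoning
  expansion : ∀ j → M zero j *S det n (minor j M)
                    ≈ (M₁ zero j *S det n (minor j M₁)) +S (M₂ zero j *S det n (minor j M₂))
  expansion j with j Fin.≟ p
  ... | yes refl = begin
    M zero j *S det n (minor j M)
      ≈⟨ *S-congʳ (det n (minor j M)) (column zero) ⟩
    (M₁ zero j +S M₂ zero j) *S det n (minor j M)
      ≈⟨ *S-distribʳ-+S (det n (minor j M)) (M₁ zero j) (M₂ zero j) ⟩
    (M₁ zero j *S det n (minor j M)) +S (M₂ zero j *S det n (minor j M))
      ≈⟨ +S-cong (*S-congˡ (M₁ zero j) (det-cong n (minor-agree M≈M₁)))
                 (*S-congˡ (M₂ zero j) (det-cong n (minor-agree M≈M₂))) ⟩
    (M₁ zero j *S det n (minor j M₁)) +S (M₂ zero j *S det n (minor j M₂)) ∎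
  ... | no j≢p = begin
    M zero j *S det n (minor j M)
      ≈⟨ *S-congˡ (M zero j) minors ⟩
    M zero j *S (det n (minor j M₁) +S det n (minor j M₂))
      ≈⟨ *S-distribˡ-+S (M zero j) (det n (minor j M₁)) (det n (minor j M₂)) ⟩
    (M zero j *S det n (minor j M₁)) +S (M zero j *S det n (minor j M₂))
      ≈⟨ +S-cong (*S-congʳ (det n (minor j M₁)) (M≈M₁ zero j j≢p))
                 (*S-congʳ (det n (minor j M₂)) (M≈M₂ zero j j≢p)) ⟩
    (M₁ zero j *S det n (minor j M₁)) +S (M₂ zero j *S det n (minor j M₂)) ∎
    where
    minors : det n (minor j M) ≈ det n (minor j M₁) +S det n (minor j M₂)
    minors = det-linear-column n (punchOut j≢p)
      (λ r → subst (λ q → M (suc r) q ≈ M₁ (suc r) q +S M₂ (suc r) q)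
                   (sym (FinP.punchIn-punchOut j≢p)) (column (suc r)))
      (minor-agreeOffColumn j≢p M≈M₁) (minor-agreeOffColumn j≢p M≈M₂)
  term : ∀ j → laplaceTerm n M j ≈ laplaceTerm n M₁ j +S laplaceTerm n M₂ j
  term j = ≈-trans (signS-cong (toℕ j) (expansion j)) (signS-+S (toℕ j) _ _)

replaceColumn : ∀ {n} → Fin n → (Fin n → Series) → Matrix n → Matrix n
replaceColumn p v M i j with j Fin.≟ p
... | yes _ = v i
... | no  _ = M i j

replaceColumn-at : ∀ {n} (p : Fin n) v M i → replaceColumn p v M i p ≡ v i
replaceColumn-at p v M i with p Fin.≟ p
... | yes _   = refl
... | no  p≢p = ⊥-elim (p≢p refl)

replaceColumn-off : ∀ {n} {p j : Fin n} v M i → j ≢ p → replaceColumn p v M i j ≡ M i j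
replaceColumn-off {p = p} {j} v M i j≢p with j Fin.≟ p
... | yes j≡p = ⊥-elim (j≢p j≡p)
... | no  _   = refl

spliceColumns : ∀ {n} → ℕ → Matrix n → Matrix n → Matrix n
spliceColumns l B C i j with toℕ j ≤? l
... | yes _ = B i j
... | no  _ = C i j

spliceColumns-≤ : ∀ {n} l (B C : Matrix n) i j → toℕ j ≤ l → spliceColumns l B C i j ≡ B i j
spliceColumns-≤ l B C i j j≤l with toℕ j ≤? l
... | yes _   = refl
... | no  j≰l = ⊥-elim (j≰l j≤l)

spliceColumns-> : ∀ {n} l (B C : Matrix n) i j → ¬ toℕ j ≤ l → spliceColumns l B C i j ≡ C i j
spliceColumns-> l B C i j j≰l with toℕ j ≤? l
... | yes j≤l = ⊥-elim (j≰l j≤l)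
... | no  _   = refl

spliceColumns-agreeOffColumn : ∀ {n} l {B C : Matrix n} (b : Fin n) → toℕ b ≡ suc l →
  AgreeOffColumn b (spliceColumns (suc l) B C) (spliceColumns l B C)
spliceColumns-agreeOffColumn l {B} {C} b b≡1+l i j j≢b with toℕ j ≤? l
... | yes j≤l = ≈-reflexive (spliceColumns-≤ (suc l) B C i j (ℕP.m≤n⇒m≤1+n j≤l))
... | no  j≰l = ≈-reflexive (spliceColumns-> (suc l) B C i j j≰1+l)
  where
  j≰1+l : ¬ toℕ j ≤ suc l
  j≰1+l j≤1+l with ℕP.m≤n⇒m<n∨m≡n j≤1+l
  ... | inj₁ j<1+l = j≰l (ℕP.≤-pred j<1+l)
  ... | inj₂ j≡1+l = j≢b (FinP.toℕ-injective (trans j≡1+l (sym b≡1+l)))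

module _ (α : ℚ) where

  det-·t-column : ∀ n (p : Fin n) {M M′ : Matrix n} →
    (∀ i → M i p ≈ α ·t M′ i p) → AgreeOffColumn p M M′ → det n M ≈ α ·t det n M′
  det-·t-column (suc n) p {M} {M′} column M≈M′ =
    ≈-trans (sumFinS-cong (suc n) term) (sumFinS-·t (suc n) (laplaceTerm n M′))
    where
    open ≈-Reasoning
    expansion : ∀ j → M zero j *S det n (minor j M) ≈ α ·t (M′ zero j *S det n (minor j M′))
    expansion j with j Fin.≟ p
    ... | yes refl = begin
      M zero j *S det n (minor j M)
        ≈⟨ *S-cong (column zero) (det-cong n (minor-agree M≈M′)) ⟩
      (α ·t M′ zero j) *S det n (minor j M′)
        ≈⟨ ·t-*S (M′ zero j) (det n (minor j M′)) ⟩
      α ·t (M′ zero j *S det n (minor j M′)) ∎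
    ... | no j≢p = begin
      M zero j *S det n (minor j M)
        ≈⟨ *S-cong (M≈M′ zero j j≢p) minors ⟩
      M′ zero j *S α ·t det n (minor j M′)
        ≈⟨ *S-·t (M′ zero j) (det n (minor j M′)) ⟩
      α ·t (M′ zero j *S det n (minor j M′)) ∎
      where
      minors : det n (minor j M) ≈ α ·t det n (minor j M′)
      minors = det-·t-column n (punchOut j≢p)
        (λ r → subst (λ q → M (suc r) q ≈ α ·t M′ (suc r) q)
                     (sym (FinP.punchIn-punchOut j≢p)) (column (suc r)))
        (minor-agreeOffColumn j≢p M≈M′)
    term : ∀ j → laplaceTerm n M j ≈ α ·t laplaceTerm n M′ j
    term j = ≈-trans (signS-cong (toℕ j) (expansion j)) (signS-·t (toℕ j) _)

  det-minor-adjacent : ∀ n {a b : Fin (suc n)} → Adjacent a b → {M : Matrix (suc n)} →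
    (∀ i → M i b ≈ α ·t M i a) → det n (minor a M) ≈ α ·t det n (minor b M)
  det-minor-adjacent n {a} {b} ab {M} columnb = det-·t-column n (punchOut a≢b)
    (λ r → subst₂ (λ x y → M (suc r) x ≈ α ·t M (suc r) y)
                  (sym (FinP.punchIn-punchOut a≢b)) (sym (punchIn-punchOut-adjacent ab a≢b))
                  (columnb (suc r)))
    (λ r c c≢ → ≈-reflexive (cong (M (suc r)) (punchIn-adjacent ab a≢b c≢)))
    where
    a≢b = Adjacent⇒≢ ab

  -- Only the terms of the two columns survive the expansion along the first row, and adjacency
  -- gives them opposite signs.
  det-·t-adjacent≈0 : ∀ n {a b : Fin n} → Adjacent a b → {M : Matrix n} →
    (∀ i → M i b ≈ α ·t M i a) → det n M ≈ zeroS
  det-·t-adjacent≈0 (suc n) {a} {b} ab {M} columnb = begin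
    det (suc n) M
      ≈⟨ sumFinS-pair (suc n) (laplaceTerm n M) a≢b others ⟩
    laplaceTerm n M a +S laplaceTerm n M b
      ≈⟨ +S-cong termA termB ⟩
    signS (toℕ a) (α ·t X) +S (-S signS (toℕ a) (α ·t X))
      ≈⟨ mk≈ (λ m → ℚP.+-inverseʳ (signS (toℕ a) (α ·t X) m)) ⟩
    zeroS ∎
    where
    open ≈-Reasoning
    a≢b = Adjacent⇒≢ ab
    others : ∀ j → j ≢ a → j ≢ b → laplaceTerm n M j ≈ zeroS
    others j j≢a j≢b = ≈-trans
      (signS-cong (toℕ j) (≈-trans (*S-congˡ (M zero j) minor≈0) (*S-zeroʳ (M zero j))))
      (signS-zero (toℕ j))
      where
      minor≈0 : det n (minor j M) ≈ zeroS
      minor≈0 = det-·t-adjacent≈0 n (punchOut-adjacent ab j≢a j≢b)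
        (λ r → subst₂ (λ x y → M (suc r) x ≈ α ·t M (suc r) y)
                      (sym (FinP.punchIn-punchOut j≢b)) (sym (FinP.punchIn-punchOut j≢a))
                      (columnb (suc r)))
    X = M zero a *S det n (minor b M)
    termA : laplaceTerm n M a ≈ signS (toℕ a) (α ·t X)
    termA = signS-cong (toℕ a)
      (≈-trans (*S-congˡ (M zero a) (det-minor-adjacent n ab columnb))
               (*S-·t (M zero a) (det n (minor b M))))
    termB : laplaceTerm n M b ≈ -S signS (toℕ a) (α ·t X)
    termB = subst (λ k → signS k (M zero b *S det n (minor b M)) ≈ -S signS (toℕ a) (α ·t X)) (sym ab)
      (-S-cong (signS-cong (toℕ a) (≈-trans (*S-congʳ (det n (minor b M)) (columnb zero))
                                             (·t-*S (M zero a) (det n (minor b M))))))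

  det-add-·t-adjacent : ∀ n {a b : Fin n} → Adjacent a b → {M M′ : Matrix n} →
    (∀ i → M′ i b ≈ M i b +S α ·t M i a) → AgreeOffColumn b M′ M → det n M′ ≈ det n M
  det-add-·t-adjacent n {a} {b} ab {M} {M′} columnb M′≈M = begin
    det n M′                  ≈⟨ det-linear-column n b columnb′ M′≈M M′≈shifted ⟩
    det n M +S det n shifted  ≈⟨ +S-congˡ (det n M) (det-·t-adjacent≈0 n ab shifted-b) ⟩
    det n M +S zeroS          ≈⟨ +S-identityʳ (det n M) ⟩
    det n M                   ∎
    where
    open ≈-Reasoning
    shifted : Matrix n
    shifted = replaceColumn b (λ i → α ·t M i a) M
    columnb′ : ∀ i → M′ i b ≈ M i b +S shifted i b
    columnb′ i = ≈-trans (columnb i) (+S-congˡ (M i b) (≈-reflexive (sym (replaceColumn-at b _ M i))))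
    M′≈shifted : AgreeOffColumn b M′ shifted
    M′≈shifted i j j≢b = ≈-trans (M′≈M i j j≢b) (≈-reflexive (sym (replaceColumn-off _ M i j≢b)))
    shifted-b : ∀ i → shifted i b ≈ α ·t shifted i a
    shifted-b i = ≈-reflexive (trans (replaceColumn-at b _ M i)
                                     (cong (α ·t_) (sym (replaceColumn-off _ M i (Adjacent⇒≢ ab)))))

  ColumnRecurrence : ∀ {n} → Matrix n → Matrix n → Set
  ColumnRecurrence B C = ∀ i {a b} → Adjacent a b → B i b ≈ C i b +S α ·t B i a

  det-spliceColumns-suc : ∀ s {B C : Matrix (suc s)} → ColumnRecurrence B C → ∀ l → suc l ≤ s →
    det (suc s) (spliceColumns (suc l) B C) ≈ det (suc s) (spliceColumns l B C)
  det-spliceColumns-suc s {B} {C} recurrence l 1+l≤s =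
    det-add-·t-adjacent (suc s) adjacent columnb (spliceColumns-agreeOffColumn l b b≡1+l)
    where
    open ≈-Reasoning
    a b : Fin (suc s)
    a = fromℕ< (s≤s (ℕP.<⇒≤ 1+l≤s))
    b = fromℕ< (s≤s 1+l≤s)
    a≡l : toℕ a ≡ l
    a≡l = FinP.toℕ-fromℕ< (s≤s (ℕP.<⇒≤ 1+l≤s))
    b≡1+l : toℕ b ≡ suc l
    b≡1+l = FinP.toℕ-fromℕ< (s≤s 1+l≤s)
    adjacent : Adjacent a b
    adjacent = trans b≡1+l (cong suc (sym a≡l))
    b≰l : ¬ toℕ b ≤ l
    b≰l b≤l = ℕP.1+n≰n (subst (_≤ l) b≡1+l b≤l)
    columnb : ∀ i → spliceColumns (suc l) B C i b
                    ≈ spliceColumns l B C i b +S α ·t spliceColumns l B C i a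
    columnb i = begin
      spliceColumns (suc l) B C i b  ≡⟨ spliceColumns-≤ (suc l) B C i b (ℕP.≤-reflexive b≡1+l) ⟩
      B i b                          ≈⟨ recurrence i adjacent ⟩
      C i b +S α ·t B i a            ≡⟨ cong₂ (λ x y → x +S α ·t y)
                                              (sym (spliceColumns-> l B C i b b≰l))
                                              (sym (spliceColumns-≤ l B C i a (ℕP.≤-reflexive a≡l))) ⟩
      spliceColumns l B C i b +S α ·t spliceColumns l B C i a ∎

  det-replaceFirstCol : ∀ s {B C : Matrix (suc s)} → ColumnRecurrence B C →
    det (suc s) (replaceFirstCol C B) ≈ det (suc s) B
  det-replaceFirstCol s {B} {C} recurrence = begin
    det (suc s) (replaceFirstCol C B)  ≈⟨ det-cong (suc s) firstColumn ⟩
    det (suc s) (N 0)                  ≈⟨ ≈-sym (det-N≈det-N₀ s ℕP.≤-refl) ⟩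
    det (suc s) (N s)                  ≈⟨ det-cong (suc s) allColumns ⟩
    det (suc s) B                      ∎
    where
    open ≈-Reasoning
    N : ℕ → Matrix (suc s)
    N l = spliceColumns l B C
    firstColumn : ∀ i j → replaceFirstCol C B i j ≈ N 0 i j
    firstColumn i zero    = ≈-reflexive (sym (spliceColumns-≤ 0 B C i zero z≤n))
    firstColumn i (suc j) = ≈-reflexive (sym (spliceColumns-> 0 B C i (suc j) λ ()))
    allColumns : ∀ i j → N s i j ≈ B i j
    allColumns i j = ≈-reflexive (spliceColumns-≤ s B C i j (ℕP.≤-pred (FinP.toℕ<n j)))
    det-N≈det-N₀ : ∀ l → l ≤ s → det (suc s) (N l) ≈ det (suc s) (N 0)
    det-N≈det-N₀ zero    _     = ≈-refl
    det-N≈det-N₀ (suc l) 1+l≤s =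
      ≈-trans (det-spliceColumns-suc s recurrence l 1+l≤s) (det-N≈det-N₀ l (ℕP.<⇒≤ 1+l≤s))

-- Multisections

module _ (q : ℕ) .{{_ : NonZero q}} where

  %-congʳ-+ : ∀ m {a b} → a % q ≡ b % q → (m + a) % q ≡ (m + b) % q
  %-congʳ-+ m {a} {b} a≡b = begin
    (m + a) % q              ≡⟨ %-distribˡ-+ m a q ⟩
    (m % q + a % q) % q      ≡⟨ cong (λ r → (m % q + r) % q) a≡b ⟩
    (m % q + b % q) % q      ≡⟨ %-distribˡ-+ m b q ⟨
    (m + b) % q              ∎
    where open ≡-Reasoning

  suc-%-injective : ∀ {a b} → suc a % q ≡ suc b % q → a % q ≡ b % q
  suc-%-injective {a} {b} 1+a≡1+b = begin
    a % q                    ≡⟨ wrap a ⟩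
    (ℕ.pred q + suc a) % q   ≡⟨ %-congʳ-+ (ℕ.pred q) 1+a≡1+b ⟩
    (ℕ.pred q + suc b) % q   ≡⟨ wrap b ⟨
    b % q                    ∎
    where
    open ≡-Reasoning
    wrap : ∀ a → a % q ≡ (ℕ.pred q + suc a) % q
    wrap a = trans (sym ([m+n]%n≡m%n a q)) (cong (_% q) (begin
      a + q                  ≡⟨ ℕP.+-comm a q ⟩
      q + a                  ≡⟨ cong (_+ a) (ℕP.suc-pred q) ⟨
      suc (ℕ.pred q) + a     ≡⟨ ℕP.+-suc (ℕ.pred q) a ⟨
      ℕ.pred q + suc a       ∎))

  multisection-cong : ∀ m {f g} → f ≈ g → multisection q m f ≈ multisection q m g
  multisection-cong m {f} {g} f≈g = mk≈ coefficient
    where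
    coefficient : ∀ i → multisection q m f i ≡ multisection q m g i
    coefficient i with (i % q) ℕ.≟ m
    ... | yes _ = coeff f≈g i
    ... | no  _ = refl

  multisection-+S : ∀ m f g → multisection q m (f +S g) ≈ multisection q m f +S multisection q m g
  multisection-+S m f g = mk≈ coefficient
    where
    coefficient : ∀ i → multisection q m (f +S g) i ≡ (multisection q m f +S multisection q m g) i
    coefficient i with (i % q) ℕ.≟ m
    ... | yes _ = refl
    ... | no  _ = sym (ℚP.+-identityˡ 0ℚ)

  multisection-·t : ∀ α x g → multisection q (suc x % q) (α ·t g) ≈ α ·t multisection q (x % q) g
  multisection-·t α x g = mk≈ coefficient
    where
    coefficient : ∀ i → multisection q (suc x % q) (α ·t g) i ≡ (α ·t multisection q (x % q) g) i
    coefficient zero with (0 % q) ℕ.≟ (suc x % q)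
    ... | yes _ = refl
    ... | no  _ = refl
    coefficient (suc n) with (suc n % q) ℕ.≟ (suc x % q) | (n % q) ℕ.≟ (x % q)
    ... | yes _        | yes _       = refl
    ... | no  _        | no  _       = sym (ℚP.*-zeroʳ α)
    ... | yes 1+n≡1+x  | no  n≢x     = ⊥-elim (n≢x (suc-%-injective 1+n≡1+x))
    ... | no  1+n≢1+x  | yes n≡x     = ⊥-elim (1+n≢1+x (%-congʳ-+ 1 n≡x))

-- The column recurrence

fourD² : ℕ → ℚ
fourD² d = ℤ.+ (4 * (d * d)) ℚ./ 1

+/1-* : ∀ m n → ℤ.+ (m * n) ℚ./ 1 ≡ (ℤ.+ m ℚ./ 1) ℚ.* (ℤ.+ n ℚ./ 1)
+/1-* m n =
  trans (cong (ℚ._/ 1) (ℤP.pos-* m n)) (sym (cong₂ ℚ._*_ (+/1≡mkℚ m) (+/1≡mkℚ n)))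
  where
  +/1≡mkℚ : ∀ m → ℤ.+ m ℚ./ 1 ≡ mkℚ (ℤ.+ m) 0 (Coprimality.sym (Coprimality.1-coprimeTo m))
  +/1≡mkℚ m = ℚP.normalize-coprime (Coprimality.sym (Coprimality.1-coprimeTo m))

geomS-recurrence : ∀ d → geomS d ≈ oneS +S fourD² d ·t geomS d
geomS-recurrence d = mk≈ λ where
  zero    → refl
  (suc n) → trans (+/1-* (4 * (d * d)) _) (sym (ℚP.+-identityˡ _))

Linv*geomS-recurrence : ∀ d Linv → Linv *S geomS d ≈ Linv +S fourD² d ·t (Linv *S geomS d)
Linv*geomS-recurrence d Linv = begin
  Linv *S geomS d
    ≈⟨ *S-congˡ Linv (geomS-recurrence d) ⟩
  Linv *S (oneS +S fourD² d ·t geomS d)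
    ≈⟨ *S-distribˡ-+S Linv oneS (fourD² d ·t geomS d) ⟩
  (Linv *S oneS) +S (Linv *S fourD² d ·t geomS d)
    ≈⟨ +S-cong (*S-identityʳ Linv) (*S-·t Linv (geomS d)) ⟩
  Linv +S fourD² d ·t (Linv *S geomS d) ∎
  where open ≈-Reasoning

module _ (d k : ℕ) .{{_ : NonZero k}} (Linv : Series) where

  private instance
    2k≢0 : NonZero (2 * k)
    2k≢0 = ℕP.m*n≢0 2 k

  bCoef-suc : ∀ x → bCoef d k Linv (suc x % (2 * k))
                    ≈ cHat k Linv (suc x % (2 * k)) +S fourD² d ·t bCoef d k Linv (x % (2 * k))
  bCoef-suc x = begin
    section r G
      ≈⟨ multisection-cong (2 * k) r (Linv*geomS-recurrence d Linv) ⟩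
    section r (Linv +S fourD² d ·t G)
      ≈⟨ multisection-+S (2 * k) r Linv (fourD² d ·t G) ⟩
    section r Linv +S section r (fourD² d ·t G)
      ≈⟨ +S-congˡ (section r Linv) (multisection-·t (2 * k) (fourD² d) x G) ⟩
    section r Linv +S fourD² d ·t section (x % (2 * k)) G ∎
    where
    open ≈-Reasoning
    G = Linv *S geomS d
    r = suc x % (2 * k)
    section : ℕ → Series → Series
    section = multisection (2 * k)

  Bentry-suc : ∀ {i} j → i ≤ 2 * k →
    Bentry d k Linv i (suc j) ≈ Centry k Linv i (suc j) +S fourD² d ·t Bentry d k Linv i j
  Bentry-suc {i} j i≤2k =
    subst (λ r → bCoef d k Linv r ≈ cHat k Linv r +S fourD² d ·t Bentry d k Linv i j)
          (cong (_% (2 * k)) (sym (ℕP.+-∸-assoc 1 (ℕP.≤-trans i≤2k (ℕP.m≤n+m (2 * k) j)))))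
          (bCoef-suc (j + 2 * k ∸ i))

-- Only (1 − 4d²t) · (Linv *S geomS d) = Linv is used, so the identity holds for every series
-- Linv: the hypotheses on Linv *S Lser d, on the order of the rows and on the range of the
-- columns are not needed (column indices are read modulo 2k).
mainTheorem3 : (d k : ℕ) → .{{_ : NonZero d}} → .{{_ : NonZero k}} →
    (Linv : Series) → (∀ n → (Linv *S Lser d) n ≡ oneS n) →
    (s : ℕ) → (ρ : Fin (suc s) → Fin (2 * k)) → (∀ i j → i < j → ρ i < ρ j) →
    (c : ℕ) → c + suc s ≤ 2 * k →
    ∀ n → det (suc s) (replaceFirstCol (subMatrix k (Centry k Linv) s ρ c)
                                       (subMatrix k (Bentry d k Linv) s ρ c)) n
          ≡ det (suc s) (subMatrix k (Bentry d k Linv) s ρ c) n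
mainTheorem3 d k Linv _ s ρ _ c _ =
  coeff (det-replaceFirstCol (fourD² d) s {B̃} {C̃} columnRecurrence)
  where
  B̃ C̃ : Matrix (suc s)
  B̃ = subMatrix k (Bentry d k Linv) s ρ c
  C̃ = subMatrix k (Centry k Linv) s ρ c
  columnRecurrence : ColumnRecurrence (fourD² d) B̃ C̃
  columnRecurrence i {a} ab =
    subst (λ col → Bentry d k Linv (toℕ (ρ i)) col
                     ≈ Centry k Linv (toℕ (ρ i)) col +S fourD² d ·t B̃ i a)
          (sym (trans (cong (c +_) ab) (ℕP.+-suc c (toℕ a))))
          (Bentry-suc d k Linv (c + toℕ a) (ℕP.<⇒≤ (FinP.toℕ<n (ρ i))))
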